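{- Let $k\ge2$ be an integer and $f_k(x)=\min\{x,k\}$. For every input $I$, $A_k(I)\le \mathrm{NFI}_k(\hat I)+1$, where $A_k(I)$ is the cost, with respect to $f_k$, of the solution of algorithm MH on $I$, $\hat I$ is the input obtained from $I$ by replacing every small item that MH matches with a large item in its pre-processing step (steps (4)-(5) below) by an item of size $s_1$, and $\mathrm{NFI}_k(\hat I)$ is the cost, with respect to $f_k$, of the solution of NFI on $\hat I$.
   Context: Items $I=\{1,\dots,n\}$ with sizes $1\ge s_1\ge\dots\ge s_n\ge0$; a bin is a set of items of total size at most $1$; the cost of a packing with respect to a function $g$ is $\sum_{\text{bins }B}g(|B|)$. Next Fit Increasing (NFI): sort items in non-decreasing order of size; keep a single open bin; put the next item into the open bin if it fits, otherwise open a new bin for it. Weight function $w$: $\pi_1=2$, $\pi_{i+1}=\pi_i(\pi_i-1)+1$; for $p\in(\frac1{k'+1},\frac1{k'}]$, $w(p)=\frac1{k'}$ if $k'=\pi_i-1$ for some $i$, else $w(p)=\frac{k'+1}{k'}p$; $w(0)=0$. Algorithm MH: (1) let $t$ be the number of items of size in $(\frac12,1]$ (large items); (2) $M_0=\{\lceil\frac{t+1}2\rceil,\dots,t\}$, $S=\{t+1,\dots,n\}$ (small items); (3) bipartite graph between $M_0$ and $S$ with edge $(a,b)$ iff $s_a+s_b\le1$, of cost $w(s_b)$; (4) maximum cost matching by the greedy process: queue $S$ in order $t+1,t+2,\dots$, queue $M_0$ in order $t,t-1,\dots$; with heads $j$ and $i$, if $s_i+s_j\le1$ match and remove both, else remove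 $j$; stop when a queue is empty; (5) pack each matched pair in its own bin and remove them; (6) pack the remaining items by NFI.
   Formalization: The item sizes are rational numbers. -}

module Defs where

open import Data.Bool using (Bool; true; false; if_then_else_)
open import Data.Nat as ℕ using (ℕ; _⊓_; ⌊_/2⌋)
open import Data.List using (List; []; _∷_; [_]; length; map; take; drop; reverse; filter; zip; _++_; zipWith)
open import Data.Nat.ListAction using (sum)
open import Data.Product using (_×_; _,_; proj₁; proj₂)
open import Data.Rational using (ℚ; _+_; _≤_; _<_; ½; 0ℚ; 1ℚ)
open import Data.Rational.Properties using (_≤?_; _<?_; ≤-decTotalOrder)
open import Data.List.Sort.MergeSort.Base ≤-decTotalOrder using (sort)
open import Relation.Nullary using (yes; no)

-- An instance is a list of item sizes s₁, s₂, …, sₙ (in this order).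

-- A packing is a list of bins; a bin is the list of the sizes of its items.
-- Cost of a packing w.r.t. f_k(x) = min{x, k}, applied to bin cardinalities.
fk : ℕ → ℕ → ℕ
fk k x = x ⊓ k

cost : ℕ → List (List ℚ) → ℕ
cost k bins = sum (map (λ B → fk k (length B)) bins)

nfGo : ℚ → List ℚ → List ℚ → List (List ℚ)
nfGo load bin [] = bin ∷ []
nfGo load bin (y ∷ ys) with load + y ≤? 1ℚ
... | yes _ = nfGo (load + y) (bin ++ [ y ]) ys
... | no _  = bin ∷ nfGo y [ y ] ys

nextFit : List ℚ → List (List ℚ)
nextFit [] = []
nextFit (x ∷ xs) = nfGo x [ x ] xs

NFI : List ℚ → List (List ℚ)
NFI xs = nextFit (sort xs)

isLarge : ℚ → Bool
isLarge x with ½ <? x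
... | yes _ = true
... | no _  = false

-- First argument: queue of M₀
-- (head = current i), second argument: queue of S (head = current j).
-- Returns (unmatched items of M₀ , matched flag for each element of the
-- S-queue , list of matched pairs as bins {i, j}).
greedy : List ℚ → List ℚ → List ℚ × List Bool × List (List ℚ)
greedy [] ss = [] , map (λ _ → false) ss , []
greedy (m ∷ ms) [] = m ∷ ms , [] , []
greedy (m ∷ ms) (s ∷ ss) with m + s ≤? 1ℚ
... | yes _ = let (r , bs , ps) = greedy ms ss in r , true ∷ bs , (m ∷ s ∷ []) ∷ ps
... | no _  = let (r , bs , ps) = greedy (m ∷ ms) ss in r , false ∷ bs , ps

count : List Bool → ℕ
count [] = 0
count (true ∷ bs) = ℕ.suc (count bs)
count (false ∷ bs) = count bs

unmatched : List Bool → List ℚ → List ℚ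
unmatched [] _ = []
unmatched _ [] = []
unmatched (true ∷ bs) (_ ∷ xs) = unmatched bs xs
unmatched (false ∷ bs) (x ∷ xs) = x ∷ unmatched bs xs

numLarge : List ℚ → ℕ
numLarge s = length (filter (λ x → ½ <? x) s)

-- For input s (sorted non-increasingly), with t = numLarge s:
-- large items are s₁..s_t, M₀ = {⌈(t+1)/2⌉,…,t} = positions ⌊t/2⌋+1..t,
-- S = {t+1,…,n}.  Queue of M₀ is t, t-1, …; queue of S is t+1, t+2, ….
largeItems : List ℚ → List ℚ
largeItems s = take (numLarge s) s

smallItems : List ℚ → List ℚ
smallItems s = drop (numLarge s) s

M₀ : List ℚ → List ℚ
M₀ s = drop ⌊ numLarge s /2⌋ (largeItems s)

matching : List ℚ → List ℚ × List Bool × List (List ℚ)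
matching s = greedy (reverse (M₀ s)) (smallItems s)

matchFlags : List ℚ → List Bool
matchFlags s = proj₁ (proj₂ (matching s))

remaining : List ℚ → List ℚ
remaining s = take ⌊ numLarge s /2⌋ (largeItems s)
              ++ proj₁ (matching s)
              ++ unmatched (matchFlags s) (smallItems s)

MH : List ℚ → List (List ℚ)
MH s = proj₂ (proj₂ (matching s)) ++ NFI (remaining s)

A : ℕ → List ℚ → ℕ
A k s = cost k (MH s)

-- s₁ (the largest size); irrelevant default 0 for the empty input.
head₀ : List ℚ → ℚ
head₀ [] = 0ℚ
head₀ (x ∷ _) = x

Ihat : List ℚ → List ℚ
Ihat s = largeItems s
         ++ zipWith (λ b x → if b then head₀ s else x)
                    (matchFlags s) (smallItems s)

NFIk : ℕ → List ℚ → ℕ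
NFIk k s = cost k (NFI s)

module Submission where

-- Write U for the small items left unmatched by the greedy
-- matching, L for the large items MH does not match, and m for the number
-- of matched pairs.  MH pays 2m for the pairs (k ≥ 2) plus NFI on the
-- remaining items U ∪ L.  In Î the m matched small items become copies of
-- s₁, which are large, so Î consists of U together with a set L' of large
-- items with |L'| = |L| + 2m (every large item, plus the m copies).
--
-- Since small items are ≤ ½ < large items, NFI on U ∪ L (resp. U ∪ L')
-- runs Next Fit on sort U followed by the sorted large items, and Next Fit
-- puts every large item in a bin of its own except that the first one may
-- join the last bin of U.  Hence the cost of Next Fit on u ++ l lies
-- between cost(NF u) + |l| - 1 and cost(NF u) + |l|, which gives
--   A_k(I) = 2m + NFI_k(U ∪ L) ≤ 2m + cost(NF U) + |L| = cost(NF U) + |L'|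
--          ≤ NFI_k(Î) + 1.

open import Defs
open import Data.Nat using (ℕ; _+_; _≤_; suc; zero; z≤n; s≤s; ⌊_/2⌋)
import Data.Nat.Properties as NP
open import Data.Nat.ListAction using (sum)
open import Data.Nat.ListAction.Properties using (sum-++)
open import Data.Nat.Tactic.RingSolver using (solve-∀)
open import Data.Rational using (ℚ; 0ℚ; 1ℚ; ½; _<_; _<?_) renaming (_≤_ to _≤ℚ_; _+_ to _+q_)
import Data.Rational.Properties as QP
open import Data.List using (List; []; _∷_; [_]; _++_; length; take; reverse; replicate; zipWith; map; last; head)
import Data.List.Properties as LP
open import Data.List.Relation.Unary.All as All using (All; []; _∷_)
import Data.List.Relation.Unary.All.Properties as AllP
open import Data.List.Relation.Unary.Linked as Linked using (Linked)
import Data.List.Relation.Unary.Linked.Properties as LinkedP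
import Data.List.Relation.Unary.Sorted.TotalOrder.Properties as SortedP
open import Data.List.Relation.Binary.Permutation.Propositional using (_↭_; ↭-refl; ↭-sym; ↭-trans; ↭-reflexive; prep; ↭⇒↭ₛ)
import Data.List.Relation.Binary.Permutation.Propositional.Properties as PermP
open import Data.List.Relation.Binary.Pointwise using (Pointwise-≡⇒≡)
open import Data.List.Sort.MergeSort.Base QP.≤-decTotalOrder using (sort)
open import Data.List.Sort.MergeSort.Properties QP.≤-decTotalOrder using (sort-↗; sort-↭)
open import Data.Maybe.Relation.Binary.Connected using (Connected; just; just-nothing; nothing-just; nothing)
open import Data.Product using (_×_; _,_; proj₁; proj₂)
open import Data.Empty using (⊥-elim)
open import Data.Bool using (Bool; true; false; if_then_else_)
open import Relation.Binary.PropositionalEquality hiding ([_])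
open import Relation.Binary.Bundles using (DecTotalOrder)
open import Relation.Nullary using (yes; no; ¬_)

Large : ℚ → Set
Large x = ½ < x

Small : ℚ → Set
Small x = x ≤ℚ ½

Nonneg : ℚ → Set
Nonneg x = 0ℚ ≤ℚ x

Sorted : List ℚ → Set
Sorted = Linked _≤ℚ_

sorted-unique : ∀ {xs ys} → Sorted xs → Sorted ys → xs ↭ ys → xs ≡ ys
sorted-unique xs↗ ys↗ p =
  Pointwise-≡⇒≡ (SortedP.↗↭↗⇒≋ (DecTotalOrder.totalOrder QP.≤-decTotalOrder) xs↗ ys↗ (↭⇒↭ₛ p))

all-sort : ∀ {P : ℚ → Set} xs → All P xs → All P (sort xs)
all-sort xs = PermP.All-resp-↭ (↭-sym (sort-↭ xs))

junction : ∀ θ {u l} → All (_≤ℚ θ) u → All (θ <_) l → Connected _≤ℚ_ (last u) (head l)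
junction θ {[]} {[]} _ _ = nothing
junction θ {[]} {y ∷ l} _ _ = nothing-just
junction θ {x ∷ []} {[]} _ _ = just-nothing
junction θ {x ∷ []} {y ∷ l} (x≤θ ∷ _) (θ<y ∷ _) = just (QP.<⇒≤ (QP.≤-<-trans x≤θ θ<y))
junction θ {x ∷ x' ∷ u} (_ ∷ u≤θ) l>θ = junction θ {x' ∷ u} u≤θ l>θ

sort-split : ∀ θ w u l → All (_≤ℚ θ) u → All (θ <_) l → w ↭ u ++ l → sort w ≡ sort u ++ sort l
sort-split θ w u l u≤θ l>θ w↭ul =
  sorted-unique (sort-↗ w)
    (LinkedP.++⁺ (sort-↗ u) (junction θ (all-sort u u≤θ) (all-sort l l>θ)) (sort-↗ l))
    (↭-trans (sort-↭ w) (↭-trans w↭ul (↭-sym (PermP.++⁺ (sort-↭ u) (sort-↭ l)))))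

Within₁ : ℕ → ℕ → Set
Within₁ a b = a ≤ b × b ≤ a + 1

within₁-≡ : ∀ {a b} → a ≡ b → Within₁ a b
within₁-≡ {a} refl = NP.≤-refl , NP.m≤m+n a 1

within₁-+ˡ : ∀ c {a b} → Within₁ a b → Within₁ (c + a) (c + b)
within₁-+ˡ c {a} {b} (a≤b , b≤a+1) =
  NP.+-monoʳ-≤ c a≤b , subst (c + b ≤_) (sym (NP.+-assoc c a 1)) (NP.+-monoʳ-≤ c b≤a+1)

within₁-+ʳ : ∀ c {a b} → Within₁ a b → Within₁ (a + c) (b + c)
within₁-+ʳ c {a} {b} w = subst₂ Within₁ (NP.+-comm c a) (NP.+-comm c b) (within₁-+ˡ c w)

module NextFitCost (k' : ℕ) where
  -- The estimates hold for any positive k; k ≥ 1 makes a singleton bin cost 1.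
  k : ℕ
  k = suc k'

  fk-suc : ∀ n → Within₁ (fk k (suc n)) (suc (fk k n))
  fk-suc n = s≤s (NP.⊓-monoʳ-≤ n (NP.n≤1+n k')) ,
             subst (_≤ fk k (suc n) + 1) (NP.+-comm (fk k n) 1)
                   (NP.+-monoˡ-≤ 1 (NP.⊓-monoˡ-≤ k (NP.n≤1+n n)))

  -- When the open bin is more than half full, every further large item
  -- opens a new bin, of cost 1.
  nf-large-exact : ∀ load bin ys → ½ < load → All Large ys →
                   cost k (nfGo load bin ys) ≡ fk k (length bin) + length ys
  nf-large-exact load bin [] _ _ = refl
  nf-large-exact load bin (y ∷ ys) ½<load (½<y ∷ ys-large) with load +q y QP.≤? 1ℚ
  ... | yes fits = ⊥-elim (QP.<-irrefl refl (QP.<-≤-trans (QP.+-mono-< ½<load ½<y) fits))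
  ... | no _ = cong (fk k (length bin) +_) (nf-large-exact y [ y ] ys ½<y ys-large)

  -- From an arbitrary open bin, only the first large item can join it.
  nf-large : ∀ load bin l → Nonneg load → All Large l →
             Within₁ (cost k (nfGo load bin l)) (fk k (length bin) + length l)
  nf-large load bin [] _ _ = within₁-≡ refl
  nf-large load bin (y ∷ ys) 0≤load (½<y ∷ ys-large) with load +q y QP.≤? 1ℚ
  ... | yes _ = subst₂ Within₁ (sym grown) (sym (NP.+-suc (fk k (length bin)) (length ys)))
                       (within₁-+ʳ (length ys) (fk-suc (length bin)))
    where
    grown : cost k (nfGo (load +q y) (bin ++ [ y ]) ys) ≡ fk k (suc (length bin)) + length ys
    grown = trans (nf-large-exact (load +q y) (bin ++ [ y ]) ys (QP.+-mono-≤-< 0≤load ½<y) ys-large)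
                  (cong (λ n → fk k n + length ys) (trans (LP.length-++ bin) (NP.+-comm (length bin) 1)))
  ... | no _ = within₁-≡ (cong (fk k (length bin) +_) (nf-large-exact y [ y ] ys ½<y ys-large))

  nf-append-go : ∀ load bin xs l → Nonneg load → All Nonneg xs → All Large l →
                 Within₁ (cost k (nfGo load bin (xs ++ l))) (cost k (nfGo load bin xs) + length l)
  nf-append-go load bin [] l 0≤load _ l-large
    rewrite NP.+-identityʳ (fk k (length bin)) = nf-large load bin l 0≤load l-large
  nf-append-go load bin (x ∷ xs) l 0≤load (0≤x ∷ xs-nonneg) l-large with load +q x QP.≤? 1ℚ
  ... | yes _ = nf-append-go (load +q x) (bin ++ [ x ]) xs l (QP.+-mono-≤ 0≤load 0≤x) xs-nonneg l-large
  ... | no _ = subst (Within₁ _) (sym (NP.+-assoc (fk k (length bin)) _ (length l)))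
                     (within₁-+ˡ (fk k (length bin)) (nf-append-go x [ x ] xs l 0≤x xs-nonneg l-large))

  -- Appending large items l to a list of nonnegative items u costs |l|,
  -- or |l| - 1 when the first of them joins the last bin of u.
  nf-append : ∀ u l → All Nonneg u → All Large l →
              Within₁ (cost k (nextFit (u ++ l))) (cost k (nextFit u) + length l)
  nf-append [] [] _ _ = within₁-≡ refl
  nf-append [] (y ∷ ys) _ (½<y ∷ ys-large) = within₁-≡ (nf-large-exact y [ y ] ys ½<y ys-large)
  nf-append (x ∷ u) l (0≤x ∷ u-nonneg) l-large = nf-append-go x [ x ] u l 0≤x u-nonneg l-large

  nf-longer-tail : ∀ u l l' d → All Nonneg u → All Large l → All Large l' →
                   length l' ≡ length l + d →
                   d + cost k (nextFit (u ++ l)) ≤ cost k (nextFit (u ++ l')) + 1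
  nf-longer-tail u l l' d u-nonneg l-large l'-large |l'| = begin
    d + cost k (nextFit (u ++ l))   ≤⟨ NP.+-monoʳ-≤ d (proj₁ (nf-append u l u-nonneg l-large)) ⟩
    d + (c + length l)              ≡⟨ rearrange d c (length l) ⟩
    c + (length l + d)              ≡⟨ cong (c +_) (sym |l'|) ⟩
    c + length l'                   ≤⟨ proj₂ (nf-append u l' u-nonneg l'-large) ⟩
    cost k (nextFit (u ++ l')) + 1  ∎
    where
    open NP.≤-Reasoning
    c : ℕ
    c = cost k (nextFit u)
    rearrange : ∀ d c n → d + (c + n) ≡ c + (n + d)
    rearrange = solve-∀

cost-++ : ∀ k (xs ys : List (List ℚ)) → cost k (xs ++ ys) ≡ cost k xs + cost k ys
cost-++ k xs ys = trans (cong sum (LP.map-++ _ xs ys)) (sum-++ (map _ xs) (map _ ys))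

flags : List ℚ → List ℚ → List Bool
flags ms ss = proj₁ (proj₂ (greedy ms ss))

count-all-false : ∀ (ss : List ℚ) → count (map (λ _ → false) ss) ≡ 0
count-all-false [] = refl
count-all-false (_ ∷ ss) = count-all-false ss

greedy-length : ∀ ms ss → length ms ≡ length (proj₁ (greedy ms ss)) + count (flags ms ss)
greedy-length [] ss = sym (count-all-false ss)
greedy-length (m ∷ ms) [] = sym (NP.+-identityʳ _)
greedy-length (m ∷ ms) (s ∷ ss) with m +q s QP.≤? 1ℚ
... | yes _ = trans (cong suc (greedy-length ms ss)) (sym (NP.+-suc _ _))
... | no _ = greedy-length (m ∷ ms) ss

greedy-flags-length : ∀ ms ss → length (flags ms ss) ≡ length ss
greedy-flags-length [] ss = LP.length-map _ ss
greedy-flags-length (m ∷ ms) [] = refl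
greedy-flags-length (m ∷ ms) (s ∷ ss) with m +q s QP.≤? 1ℚ
... | yes _ = cong suc (greedy-flags-length ms ss)
... | no _ = cong suc (greedy-flags-length (m ∷ ms) ss)

greedy-unmatched-all : ∀ {P : ℚ → Set} ms ss → All P ms → All P (proj₁ (greedy ms ss))
greedy-unmatched-all [] ss _ = []
greedy-unmatched-all (m ∷ ms) [] pms = pms
greedy-unmatched-all (m ∷ ms) (s ∷ ss) (pm ∷ pms) with m +q s QP.≤? 1ℚ
... | yes _ = greedy-unmatched-all ms ss pms
... | no _ = greedy-unmatched-all (m ∷ ms) ss (pm ∷ pms)

-- For k ≥ 2 each matched pair is a bin of cost f_k(2) = 2.
greedy-pairs-cost : ∀ k' ms ss →
  cost (suc (suc k')) (proj₂ (proj₂ (greedy ms ss))) ≡ count (flags ms ss) + count (flags ms ss)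
greedy-pairs-cost k' [] ss rewrite count-all-false ss = refl
greedy-pairs-cost k' (m ∷ ms) [] = refl
greedy-pairs-cost k' (m ∷ ms) (s ∷ ss) with m +q s QP.≤? 1ℚ
... | yes _ = cong suc (trans (cong suc (greedy-pairs-cost k' ms ss)) (sym (NP.+-suc c c)))
  where
  c : ℕ
  c = count (flags ms ss)
... | no _ = greedy-pairs-cost k' (m ∷ ms) ss

unmatched-all : ∀ {P : ℚ → Set} bs xs → All P xs → All P (unmatched bs xs)
unmatched-all [] xs _ = []
unmatched-all (b ∷ bs) [] _ = []
unmatched-all (true ∷ bs) (x ∷ xs) (_ ∷ pxs) = unmatched-all bs xs pxs
unmatched-all (false ∷ bs) (x ∷ xs) (px ∷ pxs) = px ∷ unmatched-all bs xs pxs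

replace-flagged-↭ : ∀ (h : ℚ) bs xs → length bs ≡ length xs →
  zipWith (λ b x → if b then h else x) bs xs ↭ replicate (count bs) h ++ unmatched bs xs
replace-flagged-↭ h [] [] _ = ↭-refl
replace-flagged-↭ h (true ∷ bs) (x ∷ xs) eq = prep h (replace-flagged-↭ h bs xs (NP.suc-injective eq))
replace-flagged-↭ h (false ∷ bs) (x ∷ xs) eq =
  ↭-trans (prep x (replace-flagged-↭ h bs xs (NP.suc-injective eq)))
          (↭-sym (PermP.shift x (replicate (count bs) h) (unmatched bs xs)))

numLarge-small : ∀ xs → All Small xs → numLarge xs ≡ 0
numLarge-small xs xs-small =
  cong length (LP.filter-none (½ <?_) (All.map (λ x≤½ ½<x → QP.<-irrefl refl (QP.<-≤-trans ½<x x≤½)) xs-small))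

numLarge-large : ∀ x xs → Large x → numLarge (x ∷ xs) ≡ suc (numLarge xs)
numLarge-large x xs ½<x = cong length (LP.filter-accept (½ <?_) ½<x)

small-head-all-small : ∀ x xs → ¬ Large x → Linked (λ a b → b ≤ℚ a) (x ∷ xs) → All Small (x ∷ xs)
small-head-all-small x xs x≯½ s↘ =
  LinkedP.Linked⇒All (λ x≤½ y≤x → QP.≤-trans y≤x x≤½) (QP.≮⇒≥ x≯½) s↘

large-then-small : ∀ s → Linked (λ a b → b ≤ℚ a) s →
  All Large (largeItems s) × All Small (smallItems s)
large-then-small [] _ = [] , []
large-then-small (x ∷ xs) s↘ with ½ <? x
... | yes ½<x rewrite numLarge-large x xs ½<x =
  let (xs-large , xs-small) = large-then-small xs (Linked.tail s↘) in ½<x ∷ xs-large , xs-small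
... | no x≯½ rewrite numLarge-small (x ∷ xs) (small-head-all-small x xs x≯½ s↘) =
  [] , small-head-all-small x xs x≯½ s↘

copies-of-first-large : ∀ n s m → All Large (take n s) → m ≤ length (take n s) →
  All Large (replicate m (head₀ s))
copies-of-first-large n s zero _ _ = []
copies-of-first-large zero s (suc m) _ ()
copies-of-first-large (suc n) [] (suc m) _ ()
copies-of-first-large (suc n) (x ∷ s) (suc m) (½<x ∷ _) _ = AllP.replicate⁺ (suc m) ½<x

module MHOn (s : List ℚ) (bounded : All (λ x → 0ℚ ≤ℚ x × x ≤ℚ 1ℚ) s)
            (s↘ : Linked (λ a b → b ≤ℚ a) s) where
  m : ℕ
  m = count (matchFlags s)

  U : List ℚ
  U = unmatched (matchFlags s) (smallItems s)

  outside leftover : List ℚ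
  outside = take ⌊ numLarge s /2⌋ (largeItems s)
  leftover = proj₁ (matching s)

  L : List ℚ
  L = outside ++ leftover

  L' : List ℚ
  L' = largeItems s ++ replicate m (head₀ s)

  large-items : All Large (largeItems s)
  large-items = proj₁ (large-then-small s s↘)

  U-small : All Small U
  U-small = unmatched-all (matchFlags s) (smallItems s) (proj₂ (large-then-small s s↘))

  U-nonneg : All Nonneg U
  U-nonneg = unmatched-all (matchFlags s) (smallItems s) (AllP.drop⁺ (numLarge s) (All.map proj₁ bounded))

  L-large : All Large L
  L-large = AllP.++⁺ (AllP.take⁺ ⌊ numLarge s /2⌋ large-items)
                     (greedy-unmatched-all (reverse (M₀ s)) (smallItems s)
                        (PermP.All-resp-↭ (↭-sym (PermP.↭-reverse (M₀ s))) (AllP.drop⁺ ⌊ numLarge s /2⌋ large-items)))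

  -- Each large item is outside M₀, an unmatched item of M₀, or matched.
  large-count : length (largeItems s) ≡ length L + m
  large-count = begin
    length (largeItems s)                 ≡⟨ cong length (sym (LP.take++drop≡id ⌊ numLarge s /2⌋ (largeItems s))) ⟩
    length (outside ++ M₀ s)              ≡⟨ LP.length-++ outside ⟩
    length outside + length (M₀ s)        ≡⟨ cong (length outside +_) M₀-count ⟩
    length outside + (length leftover + m) ≡⟨ sym (NP.+-assoc (length outside) (length leftover) m) ⟩
    (length outside + length leftover) + m ≡⟨ cong (_+ m) (sym (LP.length-++ outside)) ⟩
    length L + m                           ∎
    where
    open ≡-Reasoning
    M₀-count : length (M₀ s) ≡ length leftover + m
    M₀-count = trans (sym (LP.length-reverse (M₀ s))) (greedy-length (reverse (M₀ s)) (smallItems s))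

  -- The copies of s₁ are large, since m ≤ t.
  L'-large : All Large L'
  L'-large = AllP.++⁺ large-items
    (copies-of-first-large (numLarge s) s m large-items
       (subst (m ≤_) (sym large-count) (NP.m≤n+m m (length L))))

  L'-count : length L' ≡ length L + (m + m)
  L'-count = begin
    length L'                        ≡⟨ LP.length-++ (largeItems s) ⟩
    length (largeItems s) + length (replicate m (head₀ s))
                                     ≡⟨ cong₂ _+_ large-count (LP.length-replicate m) ⟩
    (length L + m) + m               ≡⟨ NP.+-assoc (length L) m m ⟩
    length L + (m + m)               ∎
    where open ≡-Reasoning

  remaining-sorted : sort (remaining s) ≡ sort U ++ sort L
  remaining-sorted = sort-split ½ (remaining s) U L U-small L-large
    (↭-trans (↭-reflexive (sym (LP.++-assoc outside leftover U)))
             (PermP.++-comm L U))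

  ihat-sorted : sort (Ihat s) ≡ sort U ++ sort L'
  ihat-sorted = sort-split ½ (Ihat s) U L' U-small L'-large
    (↭-trans (PermP.++⁺ˡ (largeItems s)
                (replace-flagged-↭ (head₀ s) (matchFlags s) (smallItems s)
                   (greedy-flags-length (reverse (M₀ s)) (smallItems s))))
      (↭-trans (↭-reflexive (sym (LP.++-assoc (largeItems s) (replicate m (head₀ s)) U)))
               (PermP.++-comm L' U)))

  mh-cost : ∀ k' → A (suc (suc k')) s ≡ (m + m) + NFIk (suc (suc k')) (remaining s)
  mh-cost k' = trans (cost-++ (suc (suc k')) (proj₂ (proj₂ (matching s))) (NFI (remaining s)))
                     (cong (_+ NFIk (suc (suc k')) (remaining s))
                           (greedy-pairs-cost k' (reverse (M₀ s)) (smallItems s)))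

lemma6 : (k : ℕ) → 2 ≤ k → (s : List ℚ) →
    All (λ x → 0ℚ ≤ℚ x × x ≤ℚ 1ℚ) s →
    Linked (λ a b → b ≤ℚ a) s →
    A k s ≤ NFIk k (Ihat s) + 1
lemma6 (suc (suc k')) (s≤s (s≤s z≤n)) s bounded s↘ = begin
  A k s                                         ≡⟨ mh-cost k' ⟩
  (m + m) + NFIk k (remaining s)                ≡⟨ cong (λ xs → (m + m) + cost k (nextFit xs)) remaining-sorted ⟩
  (m + m) + cost k (nextFit (sort U ++ sort L)) ≤⟨ nf-longer-tail (sort U) (sort L) (sort L') (m + m)
                                                     (all-sort U U-nonneg) (all-sort L L-large) (all-sort L' L'-large)
                                                     sorted-count ⟩
  cost k (nextFit (sort U ++ sort L')) + 1      ≡⟨ cong (λ xs → cost k (nextFit xs) + 1) (sym ihat-sorted) ⟩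
  NFIk k (Ihat s) + 1                           ∎
  where
  open MHOn s bounded s↘
  open NextFitCost (suc k') using (k; nf-longer-tail)
  open NP.≤-Reasoning
  sorted-count : length (sort L') ≡ length (sort L) + (m + m)
  sorted-count = trans (PermP.↭-length (sort-↭ L'))
                       (trans L'-count (cong (_+ (m + m)) (sym (PermP.↭-length (sort-↭ L)))))
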